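{- Let $\mathcal{P}$ be an additive hereditary graph property expressible by forbidden orientations. If every path belongs to $\mathcal{P}$, then $cyc(\mathcal{P})$ is infinite. In particular, neither the class of chordal graphs nor the class of forests is expressible by forbidden orientations.
   Context: Graphs are finite and simple; $C_k$ is the cycle with $k$ vertices. A graph property is a class of graphs closed under isomorphism; hereditary means closed under induced subgraphs, additive means closed under disjoint unions. An oriented graph is a digraph without loops, parallel arcs or pairs of opposite arcs; an orientation of a graph assigns a direction to each edge. For a set $F$ of oriented graphs, an oriented graph is $F$-free if no member of $F$ is isomorphic to an induced subdigraph of it. $\mathcal{P}$ is expressible by forbidden orientations if there is a finite set $F$ of oriented graphs such that a graph belongs to $\mathcal{P}$ iff it admits an $F$-free orientation. $cyc(\mathcal{P})$ is the set of integers $k\ge3$ with $C_k\in\mathcal{P}$. -}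

module Defs where

open import Data.Nat using (ℕ; zero; suc; _+_; _≤_; _≡ᵇ_)
open import Data.Fin using (Fin; toℕ; splitAt)
open import Data.Bool using (Bool; true; false; _∧_; _∨_; not)
open import Data.Bool.Properties using (∨-comm)
open import Data.Sum using (_⊎_; inj₁; inj₂)
open import Data.Product using (Σ; ∃; ∃-syntax; _×_; _,_)
open import Data.List using (List)
open import Data.List.Relation.Unary.All using (All)
open import Function.Definitions using (Injective)
open import Function.Bundles using (_⇔_)
open import Relation.Nullary using (¬_)
open import Relation.Binary.PropositionalEquality using (_≡_; _≢_; refl; cong; cong₂)

record Graph : Set where
  field
    n     : ℕ
    adj   : Fin n → Fin n → Bool
    sym   : ∀ i j → adj i j ≡ adj j i
    irrefl : ∀ i → adj i i ≡ false
open Graph public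

≡ᵇ-sym : ∀ a b → (a ≡ᵇ b) ≡ (b ≡ᵇ a)
≡ᵇ-sym zero zero = refl
≡ᵇ-sym zero (suc b) = refl
≡ᵇ-sym (suc a) zero = refl
≡ᵇ-sym (suc a) (suc b) = ≡ᵇ-sym a b

≡ᵇ-refl : ∀ a → (a ≡ᵇ a) ≡ true
≡ᵇ-refl zero = refl
≡ᵇ-refl (suc a) = ≡ᵇ-refl a

mkGraph : (n : ℕ) → (Fin n → Fin n → Bool) → Graph
mkGraph n r = record
  { n = n
  ; adj = λ i j → not (toℕ i ≡ᵇ toℕ j) ∧ (r i j ∨ r j i)
  ; sym = λ i j → cong₂ (λ a b → not a ∧ b) (≡ᵇ-sym (toℕ i) (toℕ j)) (∨-comm (r i j) (r j i))
  ; irrefl = λ i → cong (λ a → not a ∧ (r i i ∨ r i i)) (≡ᵇ-refl (toℕ i))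
  }

InducedEmbedding : Graph → Graph → Set
InducedEmbedding G H =
  Σ (Fin (n G) → Fin (n H)) λ f →
    Injective _≡_ _≡_ f × (∀ i j → adj H (f i) (f j) ≡ adj G i j)

Iso : Graph → Graph → Set
Iso G H =
  Σ (Fin (n G) → Fin (n H)) λ f →
  Σ (Fin (n H) → Fin (n G)) λ g →
    (∀ x → g (f x) ≡ x) × (∀ y → f (g y) ≡ y) ×
    (∀ i j → adj H (f i) (f j) ≡ adj G i j)

IsoClosed : (Graph → Set) → Set
IsoClosed P = ∀ G H → Iso G H → P G → P H

Hereditary : (Graph → Set) → Set
Hereditary P = ∀ G H → InducedEmbedding G H → P H → P G

unionRel : (G H : Graph) → Fin (n G + n H) → Fin (n G + n H) → Bool
unionRel G H i j with splitAt (n G) i | splitAt (n G) j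
... | inj₁ a | inj₁ b = adj G a b
... | inj₂ a | inj₂ b = adj H a b
... | _ | _ = false

_⊕_ : Graph → Graph → Graph
G ⊕ H = mkGraph (n G + n H) (unionRel G H)

Additive : (Graph → Set) → Set
Additive P = ∀ G H → P G → P H → P (G ⊕ H)

record OGraph : Set where
  field
    size   : ℕ
    arc    : Fin size → Fin size → Bool
    noLoop : ∀ i → arc i i ≡ false
    noOpp  : ∀ i j → arc i j ≡ true → arc j i ≡ false
open OGraph public

InducedSubdigraph : OGraph → OGraph → Set
InducedSubdigraph H D =
  Σ (Fin (size H) → Fin (size D)) λ f →
    Injective _≡_ _≡_ f × (∀ i j → arc D (f i) (f j) ≡ arc H i j)

Free : List OGraph → OGraph → Set
Free F D = All (λ H → ¬ InducedSubdigraph H D) F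

IsOrientation : Graph → OGraph → Set
IsOrientation G D =
  Σ (size D ≡ n G) λ { refl → ∀ i j → adj G i j ≡ (arc D i j ∨ arc D j i) }

ExpressibleByForbiddenOrientations : (Graph → Set) → Set
ExpressibleByForbiddenOrientations P =
  Σ (List OGraph) λ F → ∀ G → P G ⇔ (Σ OGraph λ D → IsOrientation G D × Free F D)

Path : ℕ → Graph
Path k = mkGraph k (λ i j → suc (toℕ i) ≡ᵇ toℕ j)

-- cycle with k vertices (this is C_k for k ≥ 3)
cycRel : (k : ℕ) → Fin k → Fin k → Bool
cycRel k i j = (suc (toℕ i) ≡ᵇ toℕ j) ∨ ((suc (toℕ i) ≡ᵇ k) ∧ (toℕ j ≡ᵇ 0))

Cycle : ℕ → Graph
Cycle k = mkGraph k (cycRel k)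

-- cyc(P) = { k ≥ 3 | C_k ∈ P } is infinite
CycInfinite : (Graph → Set) → Set
CycInfinite P = ∀ N → Σ ℕ λ k → N ≤ k × 3 ≤ k × P (Cycle k)

CycleIn : Graph → ℕ → Set
CycleIn G k =
  3 ≤ k × (Σ (Fin k → Fin (n G)) λ f →
    Injective _≡_ _≡_ f × (∀ i j → adj (Cycle k) i j ≡ true → adj G (f i) (f j) ≡ true))

Forest : Graph → Set
Forest G = ∀ k → ¬ CycleIn G k

Chordal : Graph → Set
Chordal G =
  ∀ k → 4 ≤ k → (f : Fin k → Fin (n G)) → Injective _≡_ _≡_ f →
    (∀ i j → adj (Cycle k) i j ≡ true → adj G (f i) (f j) ≡ true) →
    Σ (Fin k) λ i → Σ (Fin k) λ j →
      i ≢ j × adj (Cycle k) i j ≡ false × adj G (f i) (f j) ≡ true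

-- Let the sizes of the forbidden oriented graphs be at most m. An orientation of a path is a word β
-- of edge directions. In an F-free orientation of a long path, two of the 2 ^ m + 1 length-m
-- windows of β starting at multiples of a large S coincide, at positions i and i + L with L ≥ S. Orient the
-- cycle C_L by the directions β (i), …, β (i + L − 1). An induced copy in it of a member H of F
-- misses some vertex c ≤ m; cutting the cycle at c unrolls the rest onto the path vertices
-- i + c + 1, …, i + L + c − 1, and since β repeats on the window, H would be induced in the path.
-- So C_L ∈ P for arbitrarily large L. Paths are chordal forests, whereas long cycles are neither.

module Submission where

open import Data.Bool using (Bool; true; false; _∧_; _∨_; not)
open import Data.Bool.Properties using (not-injective; T-≡)
open import Data.Empty using (⊥; ⊥-elim)
open import Data.Fin using (Fin; toℕ; fromℕ<; combine) renaming (zero to fzero; suc to fsuc)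
open import Data.Fin.Properties using (toℕ-injective; toℕ-fromℕ<; toℕ<n; combine-injective; pigeonhole; any?; ¬∀⟶∃¬)
open import Data.List using (List; map; allFin)
open import Data.List.Extrema.Nat using (max; xs≤max; argmax; f[xs]≤f[argmax])
open import Data.List.Membership.Propositional.Properties using (∈-allFin)
open import Data.List.Relation.Unary.All as All using (All)
open import Data.List.Relation.Unary.All.Properties using (map⁻)
open import Data.Nat using (ℕ; zero; suc; _+_; _*_; _^_; _≤_; _<_; _≡ᵇ_; _<?_; z≤n; s≤s; s≤s⁻¹; z<s; pred)
open import Data.Nat.Properties
open import Data.Product using (Σ; ∃; ∃₂; _×_; _,_; proj₁; proj₂)
open import Data.Sum using (_⊎_; inj₁; inj₂)
open import Function.Bundles using (Equivalence)
open import Function.Definitions using (Injective)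
open import Relation.Nullary using (¬_; yes; no)
open import Relation.Binary.Definitions using (tri<; tri≈; tri>)
open import Relation.Binary.PropositionalEquality
open import Defs hiding (sym)

true≢false : true ≢ false
true≢false ()

bool-ext : ∀ {x y : Bool} → (x ≡ true → y ≡ true) → (y ≡ true → x ≡ true) → x ≡ y
bool-ext {false} {false} _ _ = refl
bool-ext {false} {true}  _ g = g refl
bool-ext {true}  {false} f _ = sym (f refl)
bool-ext {true}  {true}  _ _ = refl

≢true⇒≡false : ∀ {x} → x ≢ true → x ≡ false
≢true⇒≡false {false} _ = refl
≢true⇒≡false {true}  h = ⊥-elim (h refl)

∨≡true⁻ : ∀ {x y} → x ∨ y ≡ true → x ≡ true ⊎ y ≡ true
∨≡true⁻ {true}  _ = inj₁ refl
∨≡true⁻ {false} e = inj₂ e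

∨≡trueˡ : ∀ {x} y → x ≡ true → x ∨ y ≡ true
∨≡trueˡ _ refl = refl

∨≡trueʳ : ∀ x {y} → y ≡ true → x ∨ y ≡ true
∨≡trueʳ true  _ = refl
∨≡trueʳ false e = e

∧≡true⁻ : ∀ {x y} → x ∧ y ≡ true → x ≡ true × y ≡ true
∧≡true⁻ {true} {true} _ = refl , refl

∧≡true⁺ : ∀ {x y} → x ≡ true → y ≡ true → x ∧ y ≡ true
∧≡true⁺ refl refl = refl

≡ᵇ≡true⇒≡ : ∀ {a b} → (a ≡ᵇ b) ≡ true → a ≡ b
≡ᵇ≡true⇒≡ {a} {b} e = ≡ᵇ⇒≡ a b (Equivalence.from T-≡ e)

≡⇒≡ᵇ≡true : ∀ {a b} → a ≡ b → (a ≡ᵇ b) ≡ true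
≡⇒≡ᵇ≡true {a} {b} e = Equivalence.to T-≡ (≡⇒≡ᵇ a b e)

adj-mkGraph : ∀ n (r : Fin n → Fin n → Bool) → (∀ i → r i i ≡ false) →
  ∀ i j → adj (mkGraph n r) i j ≡ (r i j ∨ r j i)
adj-mkGraph n r irr i j with toℕ i ≡ᵇ toℕ j in eq
... | false = refl
... | true with refl ← toℕ-injective {i = i} {j} (≡ᵇ≡true⇒≡ eq) = sym (cong₂ _∨_ (irr i) (irr i))

pathSucc : ℕ → ℕ → Bool
pathSucc a b = suc a ≡ᵇ b

pathSucc-irrefl : ∀ a → pathSucc a a ≡ false
pathSucc-irrefl a = ≢true⇒≡false λ e → 1+n≢n (≡ᵇ≡true⇒≡ {suc a} e)

pathSucc-shift : ∀ i a b → pathSucc (i + a) (i + b) ≡ pathSucc a b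
pathSucc-shift zero    a b = refl
pathSucc-shift (suc i) a b = pathSucc-shift i a b

adj-Path : ∀ N (u v : Fin N) → adj (Path N) u v ≡ (pathSucc (toℕ u) (toℕ v) ∨ pathSucc (toℕ v) (toℕ u))
adj-Path N = adj-mkGraph N (λ u v → pathSucc (toℕ u) (toℕ v)) λ u → pathSucc-irrefl (toℕ u)

cycleSucc : ℕ → ℕ → ℕ → Bool
cycleSucc L a b = (suc a ≡ᵇ b) ∨ ((suc a ≡ᵇ L) ∧ (b ≡ᵇ 0))

CycleStep : ℕ → ℕ → ℕ → Set
CycleStep L a b = b ≡ suc a ⊎ (suc a ≡ L × b ≡ 0)

cycleSucc⇒CycleStep : ∀ {L a b} → cycleSucc L a b ≡ true → CycleStep L a b
cycleSucc⇒CycleStep {a = a} {b} e with ∨≡true⁻ {suc a ≡ᵇ b} e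
... | inj₁ forward = inj₁ (sym (≡ᵇ≡true⇒≡ forward))
... | inj₂ wrap    = let (last , first) = ∧≡true⁻ wrap in inj₂ (≡ᵇ≡true⇒≡ last , ≡ᵇ≡true⇒≡ first)

CycleStep⇒cycleSucc : ∀ {L a b} → CycleStep L a b → cycleSucc L a b ≡ true
CycleStep⇒cycleSucc {a = a} (inj₁ refl) = ∨≡trueˡ _ (≡⇒≡ᵇ≡true {suc a} refl)
CycleStep⇒cycleSucc {a = a} (inj₂ (last , refl)) = ∨≡trueʳ (suc a ≡ᵇ 0) (∧≡true⁺ (≡⇒≡ᵇ≡true last) refl)

cycleSucc-irrefl : ∀ {L} a → 2 ≤ L → cycleSucc L a a ≡ false
cycleSucc-irrefl {L} a 2≤L = ≢true⇒≡false λ e → notStep (cycleSucc⇒CycleStep e)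
  where
  notStep : ¬ CycleStep L a a
  notStep (inj₁ a≡1+a)        = 1+n≢n (sym a≡1+a)
  notStep (inj₂ (1≡L , refl)) = <⇒≢ 2≤L 1≡L

cycleSucc-asym : ∀ {L a b} → 3 ≤ L → cycleSucc L a b ≡ true → cycleSucc L b a ≡ true → ⊥
cycleSucc-asym {L} {a} 3≤L ab ba = asym (cycleSucc⇒CycleStep ab) (cycleSucc⇒CycleStep ba)
  where
  asym : ∀ {b} → CycleStep L a b → ¬ CycleStep L b a
  asym (inj₁ refl)            (inj₁ a≡2+a)        = <⇒≢ (m≤n⇒m≤1+n (n<1+n a)) a≡2+a
  asym (inj₁ refl)            (inj₂ (2≡L , refl)) = <⇒≢ 3≤L 2≡L
  asym (inj₂ (1+a≡L , refl)) (inj₁ refl)          = <⇒≢ 3≤L 1+a≡L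
  asym (inj₂ (1≡L , refl))   (inj₂ (_ , refl))    = <⇒≢ (<⇒≤ 3≤L) 1≡L

adj-Cycle : ∀ {L} → 2 ≤ L → (u v : Fin L) → adj (Cycle L) u v ≡ (cycleSucc L (toℕ u) (toℕ v) ∨ cycleSucc L (toℕ v) (toℕ u))
adj-Cycle {L} 2≤L = adj-mkGraph L (λ u v → cycleSucc L (toℕ u) (toℕ v)) λ u → cycleSucc-irrefl (toℕ u) 2≤L

orient : (ℕ → ℕ → Bool) → (ℕ → Bool) → ℕ → ℕ → Bool
orient Q β x y = (Q x y ∧ β x) ∨ (Q y x ∧ not (β y))

orient-∨ : ∀ Q β x y → (orient Q β x y ∨ orient Q β y x) ≡ (Q x y ∨ Q y x)
orient-∨ Q β x y with Q x y | Q y x | β x | β y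
... | false | false | _     | _     = refl
... | false | true  | _     | false = refl
... | false | true  | _     | true  = refl
... | true  | _     | true  | _     = refl
... | true  | false | false | _     = refl
... | true  | true  | false | false = refl
... | true  | true  | false | true  = refl

orient≡true⁻ : ∀ Q β x y → orient Q β x y ≡ true →
  (Q x y ≡ true × β x ≡ true) ⊎ (Q y x ≡ true × β y ≡ false)
orient≡true⁻ Q β x y e with ∨≡true⁻ {Q x y ∧ β x} e
... | inj₁ forward  = inj₁ (∧≡true⁻ forward)
... | inj₂ backward = let Qyx , ¬βy = ∧≡true⁻ {Q y x} backward in inj₂ (Qyx , not-injective ¬βy)

orient-irrefl : ∀ Q β x → Q x x ≡ false → orient Q β x x ≡ false
orient-irrefl Q β x Qxx = cong₂ _∨_ (cong (_∧ β x) Qxx) (cong (_∧ not (β x)) Qxx)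

orient-asym : ∀ Q β x y → (Q x y ≡ true → Q y x ≡ true → ⊥) →
  orient Q β x y ≡ true → orient Q β y x ≡ false
orient-asym Q β x y Q-asym xy = ≢true⇒≡false λ yx →
  opposite (orient≡true⁻ Q β x y xy) (orient≡true⁻ Q β y x yx)
  where
  opposite : _ → _ → ⊥
  opposite (inj₁ (Qxy , _))  (inj₁ (Qyx , _))  = Q-asym Qxy Qyx
  opposite (inj₁ (_ , βx))   (inj₂ (_ , ¬βx))  = true≢false (trans (sym βx) ¬βx)
  opposite (inj₂ (_ , ¬βy))  (inj₁ (_ , βy))   = true≢false (trans (sym βy) ¬βy)
  opposite (inj₂ (Qyx , _))  (inj₂ (Qxy , _))  = Q-asym Qxy Qyx

orient-cong : ∀ Q Q′ β β′ {x y x′ y′} → Q x y ≡ Q′ x′ y′ → Q y x ≡ Q′ y′ x′ →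
  β x ≡ β′ x′ → β y ≡ β′ y′ → orient Q β x y ≡ orient Q′ β′ x′ y′
orient-cong _ _ _ _ Qxy Qyx βx βy = cong₂ _∨_ (cong₂ _∧_ Qxy βx) (cong₂ _∧_ Qyx (cong not βy))

orientedCycle : (ℕ → Bool) → (L : ℕ) → 3 ≤ L → OGraph
orientedCycle β L 3≤L = record
  { size   = L
  ; arc    = λ u v → orient (cycleSucc L) β (toℕ u) (toℕ v)
  ; noLoop = λ u → orient-irrefl (cycleSucc L) β (toℕ u) (cycleSucc-irrefl (toℕ u) (<⇒≤ 3≤L))
  ; noOpp  = λ u v → orient-asym (cycleSucc L) β (toℕ u) (toℕ v) (cycleSucc-asym 3≤L)
  }

orientedCycle-isOrientation : ∀ β L (3≤L : 3 ≤ L) → IsOrientation (Cycle L) (orientedCycle β L 3≤L)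
orientedCycle-isOrientation β L 3≤L = refl , λ u v →
  trans (adj-Cycle (<⇒≤ 3≤L) u v) (sym (orient-∨ (cycleSucc L) β (toℕ u) (toℕ v)))

orientedPath-directions : ∀ {N} D → IsOrientation (Path N) D →
  Σ (ℕ → Bool) λ β → ∀ u v → arc D u v ≡ orient pathSucc β (toℕ u) (toℕ v)
orientedPath-directions D (refl , isOrientation) = direction , arc≡orient
  where
  N = size D

  direction : ℕ → Bool
  direction q with suc q <? N
  ... | yes q+1<N = arc D (fromℕ< (<-trans (n<1+n q) q+1<N)) (fromℕ< q+1<N)
  ... | no _      = false

  direction-arc : ∀ u v → toℕ v ≡ suc (toℕ u) → direction (toℕ u) ≡ arc D u v
  direction-arc u v v≡u+1 with suc (toℕ u) <? N
  ... | yes u+1<N = cong₂ (arc D) (toℕ-injective (toℕ-fromℕ< _))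
                                  (toℕ-injective (trans (toℕ-fromℕ< u+1<N) (sym v≡u+1)))
  ... | no u+1≮N  = ⊥-elim (u+1≮N (subst (_< N) v≡u+1 (toℕ<n v)))

  edge : ∀ u v → (arc D u v ∨ arc D v u) ≡ (pathSucc (toℕ u) (toℕ v) ∨ pathSucc (toℕ v) (toℕ u))
  edge u v = trans (sym (isOrientation u v)) (adj-Path N u v)

  step : ∀ {u v : Fin N} → pathSucc (toℕ u) (toℕ v) ≡ true → toℕ v ≡ suc (toℕ u)
  step {u} e = sym (≡ᵇ≡true⇒≡ {suc (toℕ u)} e)

  arc≡orient : ∀ u v → arc D u v ≡ orient pathSucc direction (toℕ u) (toℕ v)
  arc≡orient u v = bool-ext forward backward
    where
    forward : arc D u v ≡ true → orient pathSucc direction (toℕ u) (toℕ v) ≡ true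
    forward uv with ∨≡true⁻ {pathSucc (toℕ u) (toℕ v)} (trans (sym (edge u v)) (∨≡trueˡ _ uv))
    ... | inj₁ u→v = ∨≡trueˡ _ (∧≡true⁺ u→v (trans (direction-arc u v (step u→v)) uv))
    ... | inj₂ v→u = ∨≡trueʳ _ (∧≡true⁺ v→u (cong not (trans (direction-arc v u (step v→u)) (noOpp D u v uv))))
    backward : orient pathSucc direction (toℕ u) (toℕ v) ≡ true → arc D u v ≡ true
    backward o with orient≡true⁻ pathSucc direction (toℕ u) (toℕ v) o
    ... | inj₁ (u→v , βu) = trans (sym (direction-arc u v (step u→v))) βu
    ... | inj₂ (v→u , ¬βv) with ∨≡true⁻ {arc D u v} (trans (edge u v) (∨≡trueʳ _ v→u))
    ...   | inj₁ uv = uv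
    ...   | inj₂ vu = ⊥-elim (true≢false (trans (sym vu) (trans (sym (direction-arc v u (step v→u))) ¬βv)))

bitCode : Bool → Fin 2
bitCode false = fzero
bitCode true  = fsuc fzero

bitCode-injective : ∀ {a b} → bitCode a ≡ bitCode b → a ≡ b
bitCode-injective {false} {false} _ = refl
bitCode-injective {true}  {true}  _ = refl

windowCode : (m : ℕ) → (ℕ → Bool) → Fin (2 ^ m)
windowCode zero    w = fzero
windowCode (suc m) w = combine (bitCode (w 0)) (windowCode m (λ q → w (suc q)))

windowCode-injective : ∀ m w w′ → windowCode m w ≡ windowCode m w′ → ∀ q → q < m → w q ≡ w′ q
windowCode-injective (suc m) w w′ e zero    _ = bitCode-injective (proj₁ (combine-injective _ _ _ _ e))
windowCode-injective (suc m) w w′ e (suc q) (s≤s q<m) =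
  windowCode-injective m _ _ (proj₂ (combine-injective (bitCode (w 0)) _ (bitCode (w′ 0)) _ e)) q q<m

repeatedWindow : ∀ (β : ℕ → Bool) m S → ∃₂ λ i L →
  S ≤ L × i + L ≤ 2 ^ m * S × (∀ q → q < m → β (i + L + q) ≡ β (i + q))
repeatedWindow β m S with pigeonhole (n<1+n (2 ^ m)) (λ t → windowCode m (λ q → β (toℕ t * S + q)))
... | t , t′ , t<t′ , same with m≤n⇒∃[o]m+o≡n t<t′
... | d , t+1+d≡t′ = toℕ t * S , suc d * S , m≤m+n S (d * S) , fits , repeats
  where
  ends : toℕ t * S + suc d * S ≡ toℕ t′ * S
  ends = trans (sym (*-distribʳ-+ S (toℕ t) (suc d))) (cong (_* S) (trans (+-suc (toℕ t) d) t+1+d≡t′))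
  fits : toℕ t * S + suc d * S ≤ 2 ^ m * S
  fits = subst (_≤ 2 ^ m * S) (sym ends) (*-monoˡ-≤ S (s≤s⁻¹ (toℕ<n t′)))
  repeats : ∀ q → q < m → β (toℕ t * S + suc d * S + q) ≡ β (toℕ t * S + q)
  repeats q q<m = trans (cong (λ z → β (z + q)) ends) (sym (windowCode-injective m _ _ same q q<m))

¬hitsFin : ∀ {h} (g : Fin h → ℕ) → ¬ (∀ (c : Fin (suc h)) → ∃ λ x → g x ≡ toℕ c)
¬hitsFin {h} g hit with pigeonhole (n<1+n h) (λ c → proj₁ (hit c))
... | c , c′ , c<c′ , same =
  <-irrefl (trans (sym (proj₂ (hit c))) (trans (cong g same) (proj₂ (hit c′)))) c<c′

missedValue : ∀ {h} (g : Fin h → ℕ) → ∃ λ c → c ≤ h × ∀ x → g x ≢ c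
missedValue {h} g with ¬∀⟶∃¬ (suc h) _ (λ c → any? (λ x → g x ≟ toℕ c)) (¬hitsFin g)
... | c , missed = toℕ c , s≤s⁻¹ (toℕ<n c) , λ x gx≡c → missed (x , gx≡c)

module Unrolling (D : OGraph) (β : ℕ → Bool)
  (arc≡orient : ∀ u v → arc D u v ≡ orient pathSucc β (toℕ u) (toℕ v))
  {i L m : ℕ} (3≤L : 3 ≤ L) (m<L : m < L)
  (repeats : ∀ q → q < m → β (i + L + q) ≡ β (i + q))
  (fits : i + (L + m) ≤ size D) where

  shifted : ℕ → Bool
  shifted q = β (i + q)

  cycle : OGraph
  cycle = orientedCycle shifted L 3≤L

  module Cut (c : ℕ) (c≤m : c ≤ m) where

    unroll : ℕ → ℕ
    unroll a with c <? a
    ... | yes _ = a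
    ... | no _  = L + a

    unroll-after : ∀ {a} → c < a → unroll a ≡ a
    unroll-after {a} c<a with c <? a
    ... | yes _   = refl
    ... | no  c≮a = ⊥-elim (c≮a c<a)

    unroll-before : ∀ {a} → a < c → unroll a ≡ L + a
    unroll-before {a} a<c with c <? a
    ... | yes c<a = ⊥-elim (<-asym a<c c<a)
    ... | no  _   = refl

    data Position (a : ℕ) : Set where
      after  : c < a → Position a
      before : a < c → Position a

    position : ∀ a → a ≢ c → Position a
    position a a≢c with <-cmp a c
    ... | tri< a<c _ _ = before a<c
    ... | tri≈ _ a≡c _ = ⊥-elim (a≢c a≡c)
    ... | tri> _ _ c<a = after c<a

    c<L : c < L
    c<L = ≤-<-trans c≤m m<L

    unroll-step : ∀ {a b} → a < L → b < L → Position a → Position b →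
      (unroll b ≡ suc (unroll a) → CycleStep L a b) × (CycleStep L a b → unroll b ≡ suc (unroll a))
    unroll-step a<L b<L (after c<a) (after c<b) rewrite unroll-after c<a | unroll-after c<b =
      inj₁ , λ { (inj₁ b≡1+a) → b≡1+a ; (inj₂ (_ , refl)) → ⊥-elim (n≮0 c<b) }
    unroll-step {a} a<L b<L (before a<c) (before b<c) rewrite unroll-before a<c | unroll-before b<c =
      (λ e → inj₁ (+-cancelˡ-≡ L _ _ (trans e (sym (+-suc L a))))) ,
      λ { (inj₁ b≡1+a) → trans (cong (L +_) b≡1+a) (+-suc L a)
        ; (inj₂ (1+a≡L , _)) → ⊥-elim (<-irrefl 1+a≡L (≤-<-trans a<c c<L)) }
    unroll-step {a} {b} a<L b<L (after c<a) (before b<c) rewrite unroll-after c<a | unroll-before b<c =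
      wrap b ,
      λ { (inj₁ b≡1+a) → ⊥-elim (<-asym (<-trans b<c c<a) (subst (a <_) (sym b≡1+a) (n<1+n a)))
        ; (inj₂ (1+a≡L , refl)) → trans (+-identityʳ L) (sym 1+a≡L) }
      where
      wrap : ∀ b → L + b ≡ suc a → CycleStep L a b
      wrap zero    e = inj₂ (sym (trans (sym (+-identityʳ L)) e) , refl)
      wrap (suc b) e = ⊥-elim (<⇒≱ a<L (subst (L ≤_) (suc-injective (trans (sym (+-suc L b)) e)) (m≤m+n L b)))
    unroll-step {a} a<L b<L (before a<c) (after c<b) rewrite unroll-before a<c | unroll-after c<b =
      (λ e → ⊥-elim (<⇒≱ b<L (subst (L ≤_) (sym e) (≤-trans (m≤m+n L a) (n≤1+n _))))) ,
      λ { (inj₁ b≡1+a) → ⊥-elim (<⇒≱ c<b (subst (_≤ c) (sym b≡1+a) a<c))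
        ; (inj₂ (_ , refl)) → ⊥-elim (n≮0 c<b) }

    unroll-pathSucc : ∀ {a b} → a < L → b < L → a ≢ c → b ≢ c →
      pathSucc (unroll a) (unroll b) ≡ cycleSucc L a b
    unroll-pathSucc {a} {b} a<L b<L a≢c b≢c = bool-ext
      (λ e → CycleStep⇒cycleSucc (proj₁ steps (sym (≡ᵇ≡true⇒≡ {suc (unroll a)} e))))
      (λ e → ≡⇒≡ᵇ≡true (sym (proj₂ steps (cycleSucc⇒CycleStep e))))
      where steps = unroll-step a<L b<L (position a a≢c) (position b b≢c)

    unroll-direction : ∀ {a} → a ≢ c → β (i + unroll a) ≡ shifted a
    unroll-direction {a} a≢c with position a a≢c
    ... | after c<a  = cong (λ z → β (i + z)) (unroll-after c<a)
    ... | before a<c = begin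
      β (i + unroll a) ≡⟨ cong (λ z → β (i + z)) (unroll-before a<c) ⟩
      β (i + (L + a))  ≡⟨ cong β (sym (+-assoc i L a)) ⟩
      β (i + L + a)    ≡⟨ repeats a (<-≤-trans a<c c≤m) ⟩
      β (i + a)        ∎
      where open ≡-Reasoning

    unroll-< : ∀ {a} → a < L → a ≢ c → i + unroll a < size D
    unroll-< {a} a<L a≢c = <-≤-trans (+-monoʳ-< i (within (position a a≢c))) fits
      where
      within : Position a → unroll a < L + m
      within (after c<a)  = subst (_< L + m) (sym (unroll-after c<a)) (<-≤-trans a<L (m≤m+n L m))
      within (before a<c) = subst (_< L + m) (sym (unroll-before a<c)) (+-monoʳ-< L (<-≤-trans a<c c≤m))

    unroll-injective : ∀ {a b} → a < L → b < L → a ≢ c → b ≢ c → unroll a ≡ unroll b → a ≡ b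
    unroll-injective {a} {b} a<L b<L a≢c b≢c e with position a a≢c | position b b≢c
    ... | after c<a  | after c<b  = trans (sym (unroll-after c<a)) (trans e (unroll-after c<b))
    ... | before a<c | before b<c =
      +-cancelˡ-≡ L _ _ (trans (sym (unroll-before a<c)) (trans e (unroll-before b<c)))
    ... | after c<a  | before b<c = ⊥-elim (m+n≮m L b (subst (_< L)
      (trans (sym (unroll-after c<a)) (trans e (unroll-before b<c))) a<L))
    ... | before a<c | after c<b  = ⊥-elim (m+n≮m L a (subst (_< L)
      (trans (sym (unroll-after c<b)) (trans (sym e) (unroll-before a<c))) b<L))

    avoiding-embedding-lifts : ∀ H (g : Fin (size H) → Fin L) → Injective _≡_ _≡_ g →
      (∀ x y → arc cycle (g x) (g y) ≡ arc H x y) → (∀ x → toℕ (g x) ≢ c) → InducedSubdigraph H D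
    avoiding-embedding-lifts H g g-injective g-arcs avoids = f , f-injective , f-arcs
      where
      f : Fin (size H) → Fin (size D)
      f x = fromℕ< (unroll-< (toℕ<n (g x)) (avoids x))

      toℕ-f : ∀ x → toℕ (f x) ≡ i + unroll (toℕ (g x))
      toℕ-f x = toℕ-fromℕ< (unroll-< (toℕ<n (g x)) (avoids x))

      f-injective : Injective _≡_ _≡_ f
      f-injective {x} {y} e = g-injective (toℕ-injective
        (unroll-injective (toℕ<n (g x)) (toℕ<n (g y)) (avoids x) (avoids y)
          (+-cancelˡ-≡ i _ _ (trans (sym (toℕ-f x)) (trans (cong toℕ e) (toℕ-f y))))))

      succ-agrees : ∀ z w → pathSucc (i + unroll (toℕ (g z))) (i + unroll (toℕ (g w)))
                          ≡ cycleSucc L (toℕ (g z)) (toℕ (g w))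
      succ-agrees z w = trans (pathSucc-shift i _ _)
        (unroll-pathSucc (toℕ<n (g z)) (toℕ<n (g w)) (avoids z) (avoids w))

      f-arcs : ∀ x y → arc D (f x) (f y) ≡ arc H x y
      f-arcs x y = begin
        arc D (f x) (f y)                                ≡⟨ arc≡orient (f x) (f y) ⟩
        orient pathSucc β (toℕ (f x)) (toℕ (f y))         ≡⟨ cong₂ (orient pathSucc β) (toℕ-f x) (toℕ-f y) ⟩
        orient pathSucc β (i + unroll a) (i + unroll b)    ≡⟨ orient-cong pathSucc (cycleSucc L) β shifted
                                                                (succ-agrees x y) (succ-agrees y x)
                                                                (unroll-direction (avoids x)) (unroll-direction (avoids y)) ⟩
        orient (cycleSucc L) shifted a b                   ≡⟨ g-arcs x y ⟩
        arc H x y                                          ∎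
        where
        open ≡-Reasoning
        a = toℕ (g x)
        b = toℕ (g y)

  small-embedding-lifts : ∀ H → size H ≤ m → InducedSubdigraph H cycle → InducedSubdigraph H D
  small-embedding-lifts H |H|≤m (g , g-injective , g-arcs) with missedValue (λ x → toℕ (g x))
  ... | c , c≤|H| , avoids =
    Cut.avoiding-embedding-lifts c (≤-trans c≤|H| |H|≤m) H g g-injective g-arcs avoids

FreelyOrientable : List OGraph → Graph → Set
FreelyOrientable F G = Σ OGraph λ D → IsOrientation G D × Free F D

maxSize : List OGraph → ℕ
maxSize F = max 0 (map size F)

size≤maxSize : ∀ F → All (λ H → size H ≤ maxSize F) F
size≤maxSize F = map⁻ (xs≤max 0 (map size F))

module LongCycles (F : List OGraph) (N : ℕ) where

  m S : ℕ
  m = maxSize F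
  S = 3 + N + m

  N≤S : N ≤ S
  N≤S = ≤-trans (m≤n+m N 3) (m≤m+n (3 + N) m)

  3≤S : 3 ≤ S
  3≤S = ≤-trans (m≤m+n 3 N) (m≤m+n (3 + N) m)

  m<S : m < S
  m<S = m<n+m m {3 + N} z<s

  segment-fits : ∀ {i L n} → i + L ≤ 2 ^ m * S → 2 ^ m * S + m < n → i + (L + m) ≤ n
  segment-fits {i} {L} {n} i+L≤2^mS long = begin
    i + (L + m)   ≡⟨ +-assoc i L m ⟨
    i + L + m     ≤⟨ +-monoˡ-≤ m i+L≤2^mS ⟩
    2 ^ m * S + m <⟨ long ⟩
    n             ∎
    where open ≤-Reasoning

  cycleFromWindow : ∀ D β → (∀ u v → arc D u v ≡ orient pathSucc β (toℕ u) (toℕ v)) → Free F D →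
    ∀ {i L} (3≤L : 3 ≤ L) → m < L → (∀ q → q < m → β (i + L + q) ≡ β (i + q)) → i + (L + m) ≤ size D →
    FreelyOrientable F (Cycle L)
  cycleFromWindow D β arc≡orient D-free {L = L} 3≤L m<L repeats fits =
    cycle , orientedCycle-isOrientation shifted L 3≤L ,
    All.zipWith (λ {H} (small , ¬inD) inC → ¬inD (small-embedding-lifts H small inC)) (size≤maxSize F , D-free)
    where open Unrolling D β arc≡orient 3≤L m<L repeats fits

  cycleFromPath : ∀ {n} D → IsOrientation (Path n) D → Free F D → 2 ^ m * S + m < n →
    ∃ λ L → N ≤ L × 3 ≤ L × FreelyOrientable F (Cycle L)
  cycleFromPath D D-orients@(refl , _) D-free long =
    let β , arc≡orient = orientedPath-directions D D-orients
        i , L , S≤L , i+L≤2^mS , repeats = repeatedWindow β m S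
        3≤L = ≤-trans 3≤S S≤L
    in L , ≤-trans N≤S S≤L , 3≤L , cycleFromWindow D β arc≡orient D-free 3≤L (<-≤-trans m<S S≤L) repeats
                                     (segment-fits {i} {L} i+L≤2^mS long)

freelyOrientable-longCycles : ∀ F → (∀ k → FreelyOrientable F (Path (suc k))) →
  ∀ N → ∃ λ L → N ≤ L × 3 ≤ L × FreelyOrientable F (Cycle L)
freelyOrientable-longCycles F paths N =
  let D , D-orients , D-free = paths (2 ^ m * S + m) in cycleFromPath D D-orients D-free ≤-refl
  where open LongCycles F N

expressible⇒cycInfinite : ∀ P → ExpressibleByForbiddenOrientations P → (∀ k → P (Path (suc k))) → CycInfinite P
expressible⇒cycInfinite P (F , P⇔) paths N =
  let L , N≤L , 3≤L , free = freelyOrientable-longCycles F (λ k → Equivalence.to (P⇔ _) (paths k)) N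
  in L , N≤L , 3≤L , Equivalence.from (P⇔ _) free

cycleNext : ℕ → ℕ → ℕ
cycleNext K a with suc a <? K
... | yes _ = suc a
... | no _  = 0

cycleNext-step : ∀ {K a} → a < K → CycleStep K a (cycleNext K a)
cycleNext-step {K} {a} a<K with suc a <? K
... | yes _      = inj₁ refl
... | no  a+1≮K = inj₂ (≤-antisym a<K (≮⇒≥ a+1≮K) , refl)

cycleNext-< : ∀ {K} a → a < K → cycleNext K a < K
cycleNext-< {K} a a<K with suc a <? K
... | yes a+1<K = a+1<K
... | no  _     = ≤-<-trans z≤n a<K

cyclePrev : ℕ → ℕ → ℕ
cyclePrev K zero    = pred K
cyclePrev K (suc a) = a

cyclePrev-step : ∀ {K} a → a < K → CycleStep K (cyclePrev K a) a
cyclePrev-step {suc K} zero    _ = inj₂ (refl , refl)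
cyclePrev-step         (suc a) _ = inj₁ refl

cyclePrev-< : ∀ {K} a → a < K → cyclePrev K a < K
cyclePrev-< {suc K} zero    _   = n<1+n K
cyclePrev-<         (suc a) a<K = <-trans (n<1+n a) a<K

cycleNext≢cyclePrev : ∀ {K} a → 3 ≤ K → cycleNext K a ≡ cyclePrev K a → ⊥
cycleNext≢cyclePrev {K} a 3≤K with suc a <? K
cycleNext≢cyclePrev zero          (s≤s (s≤s (s≤s _))) | yes _   = λ ()
cycleNext≢cyclePrev (suc a)       _                   | yes _   = λ e → <-irrefl (sym e) (m<n⇒m<1+n (n<1+n a))
cycleNext≢cyclePrev zero          (s≤s (s≤s (s≤s _))) | no _    = λ ()
cycleNext≢cyclePrev (suc zero)    3≤K                 | no 2≮K = λ _ → 2≮K 3≤K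
cycleNext≢cyclePrev (suc (suc a)) _                   | no _    = λ ()

cycle-neighbours : ∀ {K} → 3 ≤ K → (a : Fin K) →
  ∃₂ λ u v → u ≢ v × adj (Cycle K) a u ≡ true × adj (Cycle K) a v ≡ true
cycle-neighbours {K} 3≤K a = next , prev , next≢prev ,
  trans (adj-Cycle 2≤K a next) (∨≡trueˡ (cycleSucc K (toℕ next) (toℕ a)) (CycleStep⇒cycleSucc
    (subst (CycleStep K (toℕ a)) (sym (toℕ-fromℕ< next<K)) (cycleNext-step a<K)))) ,
  trans (adj-Cycle 2≤K a prev) (∨≡trueʳ (cycleSucc K (toℕ a) (toℕ prev)) (CycleStep⇒cycleSucc
    (subst (λ z → CycleStep K z (toℕ a)) (sym (toℕ-fromℕ< prev<K)) (cyclePrev-step (toℕ a) a<K))))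
  where
  2≤K = <⇒≤ 3≤K
  a<K = toℕ<n a
  next<K = cycleNext-< (toℕ a) a<K
  prev<K = cyclePrev-< (toℕ a) a<K
  next prev : Fin K
  next = fromℕ< next<K
  prev = fromℕ< prev<K
  next≢prev : next ≢ prev
  next≢prev e = cycleNext≢cyclePrev (toℕ a) 3≤K
    (trans (sym (toℕ-fromℕ< next<K)) (trans (cong toℕ e) (toℕ-fromℕ< prev<K)))

adj-Path-below : ∀ {N} (x y : Fin N) → toℕ y ≤ toℕ x → adj (Path N) x y ≡ true → toℕ x ≡ suc (toℕ y)
adj-Path-below {N} x y y≤x xy with ∨≡true⁻ {pathSucc (toℕ x) (toℕ y)} (trans (sym (adj-Path N x y)) xy)
... | inj₁ up   = ⊥-elim (<⇒≱ (subst (toℕ x <_) (≡ᵇ≡true⇒≡ up) (n<1+n _)) y≤x)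
... | inj₂ down = sym (≡ᵇ≡true⇒≡ {suc (toℕ y)} down)

-- The cycle vertex mapped highest on the path has both of its cycle neighbours mapped just below it.
path-has-no-cycles : ∀ {N K} → 3 ≤ K → (f : Fin K → Fin N) → Injective _≡_ _≡_ f →
  (∀ i j → adj (Cycle K) i j ≡ true → adj (Path N) (f i) (f j) ≡ true) → ⊥
path-has-no-cycles {N} {K@(suc _)} 3≤K f f-injective edges =
  let u , v , u≢v , top-u , top-v = cycle-neighbours 3≤K top
  in u≢v (f-injective (toℕ-injective (suc-injective (trans (sym (below u top-u)) (below v top-v)))))
  where
  top : Fin K
  top = argmax (λ x → toℕ (f x)) fzero (allFin K)
  below : ∀ j → adj (Cycle K) top j ≡ true → toℕ (f top) ≡ suc (toℕ (f j))
  below j e = adj-Path-below (f top) (f j)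
    (All.lookup (f[xs]≤f[argmax] {f = λ x → toℕ (f x)} fzero (allFin K)) (∈-allFin j)) (edges top j e)

path-forest : ∀ N → Forest (Path N)
path-forest N k (3≤k , f , f-injective , edges) = path-has-no-cycles 3≤k f f-injective edges

path-chordal : ∀ N → Chordal (Path N)
path-chordal N k 4≤k f f-injective edges = ⊥-elim (path-has-no-cycles (<⇒≤ 4≤k) f f-injective edges)

cycle-not-forest : ∀ {k} → 3 ≤ k → ¬ Forest (Cycle k)
cycle-not-forest 3≤k forest = forest _ (3≤k , (λ x → x) , (λ e → e) , λ _ _ e → e)

cycle-not-chordal : ∀ {k} → 4 ≤ k → ¬ Chordal (Cycle k)
cycle-not-chordal 4≤k chordal =
  let _ , _ , _ , nonEdge , edge = chordal _ 4≤k (λ x → x) (λ e → e) (λ _ _ e → e)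
  in true≢false (trans (sym edge) nonEdge)

¬expressible-Forest : ¬ ExpressibleByForbiddenOrientations Forest
¬expressible-Forest expressible =
  let _ , _ , 3≤k , forest = expressible⇒cycInfinite Forest expressible (λ k → path-forest (suc k)) 0
  in cycle-not-forest 3≤k forest

¬expressible-Chordal : ¬ ExpressibleByForbiddenOrientations Chordal
¬expressible-Chordal expressible =
  let _ , 4≤k , _ , chordal = expressible⇒cycInfinite Chordal expressible (λ k → path-chordal (suc k)) 4
  in cycle-not-chordal 4≤k chordal

proposition13 :
    ((P : Graph → Set) → IsoClosed P → Hereditary P → Additive P →
      ExpressibleByForbiddenOrientations P → (∀ k → P (Path (suc k))) →
      CycInfinite P)
    × ¬ ExpressibleByForbiddenOrientations Chordal
    × ¬ ExpressibleByForbiddenOrientations Forest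
proposition13 = (λ P _ _ _ → expressible⇒cycInfinite P) , ¬expressible-Chordal , ¬expressible-Forest
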